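{- Let $T$ be a tournament on $3$ or more vertices with a transmitter $s$ and a receiver $t$. Then $T$ is quadrangular if and only if both $\gamma(T-\{s,t\})>2$ and $\gamma((T-\{s,t\})^{r})>2$.
   Context: A tournament $T$ is a digraph with no loops such that for each pair of distinct vertices $u\neq v$ exactly one of the arcs $(u,v)$, $(v,u)$ is present; $u\rightarrow v$ means $(u,v)$ is an arc. For a vertex $v$, $O(v)=\{u:v\rightarrow u\}$ (outset) and $I(v)=\{u:u\rightarrow v\}$ (inset). A digraph $D$ is quadrangular if for all distinct vertices $u\neq v$, $|O(u)\cap O(v)|\neq 1$ and $|I(u)\cap I(v)|\neq 1$. A transmitter is a vertex dominating all other vertices; a receiver is a vertex dominated by all other vertices. $T-\{s,t\}$ is the subtournament induced on $V(T)\setminus\{s,t\}$. The dual (reversal) $T^{r}$ of a tournament $T$ has the same vertices, with $x\rightarrow y$ in $T^r$ iff $y\rightarrow x$ in $T$. A dominating set of a digraph $D$ is a set $S$ of vertices such that every vertex is in $S$ or dominated by a vertex of $S$; $\gamma(D)$ is the minimum size of a dominating set. -}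

module Defs where

open import Data.Nat using (ℕ; _≤_; _<_; _>_)
open import Data.Bool using (Bool; true; false; _∧_; not; T)
open import Data.Fin using (Fin)
open import Data.Fin.Subset using (Subset; _∈_; _⊆_; ∣_∣; ⁅_⁆; _∪_; ∁)
open import Data.Fin.Subset.Properties using ()
open import Data.Vec.Functional using (foldr)
open import Data.List using (List; filter; length)
open import Data.List using () renaming (allFin to allFinL)
open import Data.Product using (Σ; _×_; ∃)
open import Data.Sum using (_⊎_)
open import Relation.Nullary using (¬_)
open import Relation.Binary.PropositionalEquality using (_≡_; _≢_)
open import Relation.Nullary.Decidable using (does)
open import Data.Bool.Properties using (T?)

-- A digraph on vertex set Fin n, given by its (decidable) arc relation:
-- A u v = true  iff  u → v.
Digraph : ℕ → Set
Digraph n = Fin n → Fin n → Bool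

IsTournament : {n : ℕ} → Digraph n → Set
IsTournament {n} A =
  ((v : Fin n) → A v v ≡ false) ×
  ((u v : Fin n) → u ≢ v → not (A u v) ≡ A v u)

count : {n : ℕ} → (Fin n → Bool) → ℕ
count {n} p = length (filter (λ w → T? (p w)) (allFinL n))

commonOut : {n : ℕ} → Digraph n → Fin n → Fin n → ℕ
commonOut A u v = count (λ w → A u w ∧ A v w)

commonIn : {n : ℕ} → Digraph n → Fin n → Fin n → ℕ
commonIn A u v = count (λ w → A w u ∧ A w v)

Quadrangular : {n : ℕ} → Digraph n → Set
Quadrangular {n} A =
  (u v : Fin n) → u ≢ v → (commonOut A u v ≢ 1) × (commonIn A u v ≢ 1)

Transmitter : {n : ℕ} → Digraph n → Fin n → Set
Transmitter {n} A s = (v : Fin n) → v ≢ s → A s v ≡ true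

Receiver : {n : ℕ} → Digraph n → Fin n → Set
Receiver {n} A t = (v : Fin n) → v ≢ t → A v t ≡ true

reverse : {n : ℕ} → Digraph n → Digraph n
reverse A x y = A y x

-- Sub-digraphs induced on a vertex set W ⊆ Fin n are represented by the pair
-- (A, W): the vertices are the elements of W and the arcs are those of A
-- between elements of W.

IsDominatingIn : {n : ℕ} → Digraph n → Subset n → Subset n → Set
IsDominatingIn {n} A W S =
  S ⊆ W ×
  ((v : Fin n) → v ∈ W → v ∈ S ⊎ Σ (Fin n) (λ u → u ∈ S × A u v ≡ true))

γ>_ : ℕ → {n : ℕ} → Digraph n → Subset n → Set
(γ> k) {n} A W = (S : Subset n) → IsDominatingIn A W S → ∣ S ∣ > k

minus2 : {n : ℕ} → Fin n → Fin n → Subset n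
minus2 s t = ∁ (⁅ s ⁆ ∪ ⁅ t ⁆)

{-# OPTIONS --safe #-}
module Submission where

-- Let W be the vertex set of T - {s,t}. Since s beats every other vertex and
-- t beats none, s is a common in-neighbour of any two vertices u, v ≠ s, and
-- every other common in-neighbour lies in W. Hence |I(u) ∩ I(v)| = 1 means
-- that no vertex of W beats both u and v, i.e. that {u,v} ∩ W, a set of at
-- most two vertices, dominates T - {s,t}. Conversely, if |I(a) ∩ I(b)| ≠ 1
-- for all a ≠ b, then any two distinct a, b ≠ s have a common in-neighbour
-- w ∈ W, and the member of a dominating set S that is or dominates w differs
-- from a and b; starting from (t, x) with x ∈ W this produces three distinct
-- members of S. The condition on outsets is the condition on insets of the
-- reversal, in which s and t exchange their roles.

open import Defs
open import Data.Nat using (ℕ; _≥_; _≤_; _+_; _∸_; z≤n; s≤s)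
open import Data.Nat.Properties using (+-suc; +-monoʳ-≤; n≤1+n; ∸-monoˡ-≤; ∸-monoʳ-≤; ≤-trans; ≤-reflexive; 1+n≰n; <⇒≱; module ≤-Reasoning)
open import Data.Fin using (Fin)
open import Data.Fin.Properties using (_≟_; any?)
open import Data.Fin.Subset using (Subset; _∈_; _∩_; _∪_; ⁅_⁆; ∁; ∣_∣; _-_; Nonempty; ⊥; inside; outside)
open import Data.Fin.Subset.Properties
  using (x∈⁅x⁆; x∈⁅y⁆⇒x≡y; ∣⁅x⁆∣≡1; x∈p∩q⁺; p∩q⊆q; ∣p∩q∣≤∣p∣; x∈p∪q⁺; x∈p∪q⁻; ∪-comm;
         x∉p⇒x∈∁p; x∈∁p⇒x∉p; x∈p∧x≢y⇒x∈p-y; x∈p⇒∣p-x∣<∣p∣; nonempty?; Empty-unique; ∣⊥∣≡0; ∣∁p∣≡n∸∣p∣)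
open import Data.Vec using (_∷_; [])
open import Data.List using (List; _∷_; []; length; filter; allFin)
open import Data.List.Relation.Unary.Any using (here; there)
open import Data.List.Relation.Unary.All using (_∷_)
open import Data.List.Relation.Unary.AllPairs using (_∷_)
open import Data.List.Relation.Unary.Unique.Propositional using (Unique)
import Data.List.Relation.Unary.Unique.Propositional.Properties as Unique
open import Data.List.Membership.Propositional using () renaming (_∈_ to _∈ₗ_)
open import Data.List.Membership.Propositional.Properties using (∈-filter⁺; ∈-filter⁻; ∈-allFin)
open import Data.Bool using (Bool; true; false; _∧_; not)
open import Data.Bool.Properties using (T?; T-≡; ∧-conicalˡ; ∧-conicalʳ) renaming (_≟_ to _≟ᵇ_)
open import Data.Product using (_×_; _,_; proj₁; proj₂; ∃)
open import Data.Product.Function.NonDependent.Propositional using (_×-⇔_)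
open import Data.Sum using (_⊎_; inj₁; inj₂; [_,_]′)
open import Data.Empty using (⊥-elim)
open import Relation.Nullary using (¬_; ¬?; yes; no)
open import Relation.Nullary.Decidable using (decidable-stable; _×-dec_)
open import Relation.Binary.PropositionalEquality using (_≡_; _≢_; refl; sym; trans; cong; cong₂; subst; ≢-sym)
open import Function.Base using (_∘_; case_of_)
open import Function.Bundles using (_⇔_; mk⇔; Equivalence)
open import Function.Construct.Composition using (_⇔-∘_)

module _ {a} {X : Set a} where

  length≡1⇒∃-unique : {xs : List X} → length xs ≡ 1 →
                      ∃ λ x → x ∈ₗ xs × (∀ {y} → y ∈ₗ xs → y ≡ x)
  length≡1⇒∃-unique {x ∷ []} refl = x , here refl , λ { (here y≡x) → y≡x }

  unique-member⇒length≡1 : {xs : List X} {x : X} → Unique xs → x ∈ₗ xs →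
                           (∀ {y} → y ∈ₗ xs → y ≡ x) → length xs ≡ 1
  unique-member⇒length≡1 {_ ∷ []}    _                 _ _    = refl
  unique-member⇒length≡1 {_ ∷ _ ∷ _} ((y≢z ∷ _) ∷ _) _ only =
    ⊥-elim (y≢z (trans (only (here refl)) (sym (only (there (here refl))))))

module _ {n : ℕ} (p : Fin n → Bool) where

  private
    witnesses : List (Fin n)
    witnesses = filter (λ w → T? (p w)) (allFin n)

    ∈-witnesses : ∀ {w} → w ∈ₗ witnesses ⇔ p w ≡ true
    ∈-witnesses {w} = mk⇔
      (λ w∈ → Equivalence.to T-≡ (proj₂ (∈-filter⁻ (λ w → T? (p w)) {xs = allFin n} w∈)))
      (λ pw → ∈-filter⁺ (λ w → T? (p w)) (∈-allFin w) (Equivalence.from T-≡ pw))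

  count≡1⇒∃-unique : count p ≡ 1 → ∃ λ x → p x ≡ true × (∀ w → p w ≡ true → w ≡ x)
  count≡1⇒∃-unique c≡1 with length≡1⇒∃-unique c≡1
  ... | x , x∈ , only =
    x , Equivalence.to ∈-witnesses x∈ , λ w pw → only (Equivalence.from ∈-witnesses pw)

  unique⇒count≡1 : ∀ {x} → p x ≡ true → (∀ w → p w ≡ true → w ≡ x) → count p ≡ 1
  unique⇒count≡1 px only =
    unique-member⇒length≡1 (Unique.filter⁺ (λ w → T? (p w)) (Unique.allFin⁺ n))
      (Equivalence.from ∈-witnesses px) (λ {w} w∈ → only w (Equivalence.to ∈-witnesses w∈))

  count≢1⇒other-witness : ∀ {x} → p x ≡ true → count p ≢ 1 → ∃ λ w → w ≢ x × p w ≡ true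
  count≢1⇒other-witness {x} px c≢1 with any? (λ w → ¬? (w ≟ x) ×-dec (p w ≟ᵇ true))
  ... | yes other = other
  ... | no none   = ⊥-elim (c≢1 (unique⇒count≡1 px only))
    where
    only : ∀ w → p w ≡ true → w ≡ x
    only w pw = decidable-stable (w ≟ x) (λ w≢x → none (w , w≢x , pw))

∣p∪q∣≤∣p∣+∣q∣ : ∀ {n} (p q : Subset n) → ∣ p ∪ q ∣ ≤ ∣ p ∣ + ∣ q ∣
∣p∪q∣≤∣p∣+∣q∣ []            []            = z≤n
∣p∪q∣≤∣p∣+∣q∣ (outside ∷ p) (outside ∷ q) = ∣p∪q∣≤∣p∣+∣q∣ p q
∣p∪q∣≤∣p∣+∣q∣ (outside ∷ p) (inside  ∷ q) =
  ≤-trans (s≤s (∣p∪q∣≤∣p∣+∣q∣ p q)) (≤-reflexive (sym (+-suc ∣ p ∣ ∣ q ∣)))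
∣p∪q∣≤∣p∣+∣q∣ (inside  ∷ p) (outside ∷ q) = s≤s (∣p∪q∣≤∣p∣+∣q∣ p q)
∣p∪q∣≤∣p∣+∣q∣ (inside  ∷ p) (inside  ∷ q) =
  s≤s (≤-trans (∣p∪q∣≤∣p∣+∣q∣ p q) (+-monoʳ-≤ ∣ p ∣ (n≤1+n ∣ q ∣)))

module _ {n : ℕ} where

  ∣⁅x⁆∪⁅y⁆∣≤2 : (x y : Fin n) → ∣ ⁅ x ⁆ ∪ ⁅ y ⁆ ∣ ≤ 2
  ∣⁅x⁆∪⁅y⁆∣≤2 x y = begin
    ∣ ⁅ x ⁆ ∪ ⁅ y ⁆ ∣   ≤⟨ ∣p∪q∣≤∣p∣+∣q∣ ⁅ x ⁆ ⁅ y ⁆ ⟩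
    ∣ ⁅ x ⁆ ∣ + ∣ ⁅ y ⁆ ∣ ≡⟨ cong₂ _+_ (∣⁅x⁆∣≡1 x) (∣⁅x⁆∣≡1 y) ⟩
    2                   ∎
    where open ≤-Reasoning

  distinct∈p⇒3≤∣p∣ : ∀ {p : Subset n} {a b c} → a ∈ p → b ∈ p → c ∈ p →
                     a ≢ b → a ≢ c → b ≢ c → 3 ≤ ∣ p ∣
  distinct∈p⇒3≤∣p∣ {p} {a} {b} {c} a∈p b∈p c∈p a≢b a≢c b≢c = begin
    3                       ≤⟨ s≤s (s≤s (s≤s z≤n)) ⟩
    3 + ∣ p - a - b - c ∣   ≤⟨ s≤s (s≤s (x∈p⇒∣p-x∣<∣p∣ c∈p-a-b)) ⟩
    2 + ∣ p - a - b ∣       ≤⟨ s≤s (x∈p⇒∣p-x∣<∣p∣ b∈p-a) ⟩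
    1 + ∣ p - a ∣           ≤⟨ x∈p⇒∣p-x∣<∣p∣ a∈p ⟩
    ∣ p ∣                   ∎
    where
    open ≤-Reasoning
    b∈p-a : b ∈ p - a
    b∈p-a = x∈p∧x≢y⇒x∈p-y b∈p (≢-sym a≢b)
    c∈p-a-b : c ∈ p - a - b
    c∈p-a-b = x∈p∧x≢y⇒x∈p-y (x∈p∧x≢y⇒x∈p-y c∈p (≢-sym a≢c)) (≢-sym b≢c)

  ∈-minus2⁺ : ∀ {s t x : Fin n} → x ≢ s → x ≢ t → x ∈ minus2 s t
  ∈-minus2⁺ {s} {t} x≢s x≢t = x∉p⇒x∈∁p λ x∈s∪t →
    [ x≢s ∘ x∈⁅y⁆⇒x≡y s , x≢t ∘ x∈⁅y⁆⇒x≡y t ]′ (x∈p∪q⁻ ⁅ s ⁆ ⁅ t ⁆ x∈s∪t)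

  ∈-minus2⁻ : ∀ {s t x : Fin n} → x ∈ minus2 s t → x ≢ s × x ≢ t
  ∈-minus2⁻ {s} {t} x∈ =
    (λ { refl → x∈∁p⇒x∉p x∈ (x∈p∪q⁺ (inj₁ (x∈⁅x⁆ s))) }) ,
    (λ { refl → x∈∁p⇒x∉p x∈ (x∈p∪q⁺ (inj₂ (x∈⁅x⁆ t))) })

  minus2-comm : (s t : Fin n) → minus2 s t ≡ minus2 t s
  minus2-comm s t = cong ∁ (∪-comm ⁅ s ⁆ ⁅ t ⁆)

  minus2-nonempty : 3 ≤ n → (s t : Fin n) → Nonempty (minus2 s t)
  minus2-nonempty n≥3 s t with nonempty? (minus2 s t)
  ... | yes nonempty = nonempty
  ... | no  empty    = ⊥-elim (1+n≰n (begin
    1                           ≤⟨ ∸-monoˡ-≤ 2 n≥3 ⟩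
    n ∸ 2                       ≤⟨ ∸-monoʳ-≤ n (∣⁅x⁆∪⁅y⁆∣≤2 s t) ⟩
    n ∸ ∣ ⁅ s ⁆ ∪ ⁅ t ⁆ ∣       ≡⟨ sym (∣∁p∣≡n∸∣p∣ (⁅ s ⁆ ∪ ⁅ t ⁆)) ⟩
    ∣ minus2 s t ∣              ≡⟨ cong ∣_∣ (Empty-unique empty) ⟩
    ∣ ⊥ {n = n} ∣               ≡⟨ ∣⊥∣≡0 n ⟩
    0                           ∎))
    where open ≤-Reasoning

InQuadrangular : ∀ {n} → Digraph n → Set
InQuadrangular {n} A = (u v : Fin n) → u ≢ v → commonIn A u v ≢ 1

Quadrangular⇔InQuadrangular×reverse : ∀ {n} (A : Digraph n) →
  Quadrangular A ⇔ (InQuadrangular A × InQuadrangular (reverse A))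
Quadrangular⇔InQuadrangular×reverse A = mk⇔
  (λ quad → (λ u v u≢v → proj₂ (quad u v u≢v)) , (λ u v u≢v → proj₁ (quad u v u≢v)))
  (λ { (inQuad , outQuad) u v u≢v → outQuad u v u≢v , inQuad u v u≢v })

reverse-isTournament : ∀ {n} {A : Digraph n} → IsTournament A → IsTournament (reverse A)
reverse-isTournament (loopless , oriented) = loopless , λ u v u≢v → oriented v u (≢-sym u≢v)

module Tournament {n} {A : Digraph n} (tour : IsTournament A) where

  asymmetric : ∀ {u v} → A u v ≡ true → ¬ A v u ≡ true
  asymmetric {u} {v} uv vu with u ≟ v
  ... | yes refl = case trans (sym uv) (proj₁ tour u) of λ ()
  ... | no  u≢v  = case trans (trans (cong not (sym uv)) (proj₂ tour u v u≢v)) vu of λ ()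

  irreflexive : ∀ {v} → ¬ A v v ≡ true
  irreflexive vv = asymmetric vv vv

  connex : ∀ {u v} → u ≢ v → A u v ≡ true ⊎ A v u ≡ true
  connex {u} {v} u≢v with A u v in uv
  ... | true  = inj₁ refl
  ... | false = inj₂ (trans (sym (proj₂ tour u v u≢v)) (cong not uv))

module _ {n} {A : Digraph n} (tour : IsTournament A) {s t : Fin n}
         (tr : Transmitter A s) (rc : Receiver A t) where

  open Tournament tour

  nothing-beats-transmitter : ∀ {w} → ¬ A w s ≡ true
  nothing-beats-transmitter {w} ws with w ≟ s
  ... | yes refl = irreflexive ws
  ... | no  w≢s  = asymmetric ws (tr w w≢s)

  receiver-beats-nothing : ∀ {w} → ¬ A t w ≡ true
  receiver-beats-nothing {w} tw with w ≟ t
  ... | yes refl = irreflexive tw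
  ... | no  w≢t  = asymmetric tw (rc w w≢t)

  transmitter≢receiver : Nonempty (minus2 s t) → s ≢ t
  transmitter≢receiver (x , x∈W) refl = asymmetric (tr x x≢s) (rc x x≢s)
    where x≢s = proj₁ (∈-minus2⁻ x∈W)

  beats⇒∈minus2 : ∀ {u x} → u ≢ s → A u x ≡ true → u ∈ minus2 s t
  beats⇒∈minus2 u≢s ux = ∈-minus2⁺ u≢s λ { refl → receiver-beats-nothing ux }

  common-in-neighbour : ∀ {a b} → a ≢ s → b ≢ s → commonIn A a b ≢ 1 →
                        ∃ λ w → w ∈ minus2 s t × A w a ≡ true × A w b ≡ true
  common-in-neighbour {a} {b} a≢s b≢s c≢1
    with count≢1⇒other-witness (λ w → A w a ∧ A w b) (cong₂ _∧_ (tr a a≢s) (tr b b≢s)) c≢1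
  ... | w , w≢s , wab =
    w , beats⇒∈minus2 w≢s (∧-conicalˡ _ _ wab) , ∧-conicalˡ _ _ wab , ∧-conicalʳ _ _ wab

  module _ (inQuad : InQuadrangular A) {S : Subset n}
           (S-dom : IsDominatingIn A (minus2 s t) S) where

    dominator-avoiding : ∀ {a b} → a ≢ b → a ≢ s → b ≢ s → ∃ λ c → c ∈ S × a ≢ c × b ≢ c
    dominator-avoiding a≢b a≢s b≢s with common-in-neighbour a≢s b≢s (inQuad _ _ a≢b)
    ... | w , w∈W , wa , wb with proj₂ S-dom w w∈W
    ...   | inj₁ w∈S =
      w , w∈S , (λ { refl → irreflexive wa }) , (λ { refl → irreflexive wb })
    ...   | inj₂ (c , c∈S , cw) =
      c , c∈S , (λ { refl → asymmetric cw wa }) , (λ { refl → asymmetric cw wb })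

    dominating⇒3≤∣S∣ : Nonempty (minus2 s t) → 3 ≤ ∣ S ∣
    dominating⇒3≤∣S∣ (x , x∈W) =
      let (c₁ , c₁∈S , t≢c₁ , _)       = dominator-avoiding (≢-sym x≢t) t≢s x≢s
          (c₂ , c₂∈S , _ , c₁≢c₂)      = dominator-avoiding t≢c₁ t≢s (≢s c₁∈S)
          (c₃ , c₃∈S , c₁≢c₃ , c₂≢c₃) = dominator-avoiding c₁≢c₂ (≢s c₁∈S) (≢s c₂∈S)
      in  distinct∈p⇒3≤∣p∣ c₁∈S c₂∈S c₃∈S c₁≢c₂ c₁≢c₃ c₂≢c₃
      where
      x≢s = proj₁ (∈-minus2⁻ x∈W)
      x≢t = proj₂ (∈-minus2⁻ x∈W)
      t≢s = ≢-sym (transmitter≢receiver (x , x∈W))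
      ≢s : ∀ {c} → c ∈ S → c ≢ s
      ≢s c∈S = proj₁ (∈-minus2⁻ (proj₁ S-dom c∈S))

  pair-dominates : ∀ {u v} → u ≢ s → v ≢ s → (∀ w → A w u ≡ true → A w v ≡ true → w ≡ s) →
                   IsDominatingIn A (minus2 s t) ((⁅ u ⁆ ∪ ⁅ v ⁆) ∩ minus2 s t)
  pair-dominates {u} {v} u≢s v≢s only-s = p∩q⊆q (⁅ u ⁆ ∪ ⁅ v ⁆) (minus2 s t) , dominated
    where
    pair∋ : ∀ {x} → x ≡ u ⊎ x ≡ v → x ∈ minus2 s t → x ∈ (⁅ u ⁆ ∪ ⁅ v ⁆) ∩ minus2 s t
    pair∋ (inj₁ refl) x∈W = x∈p∩q⁺ (x∈p∪q⁺ (inj₁ (x∈⁅x⁆ u)) , x∈W)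
    pair∋ (inj₂ refl) x∈W = x∈p∩q⁺ (x∈p∪q⁺ (inj₂ (x∈⁅x⁆ v)) , x∈W)

    dominated : ∀ x → x ∈ minus2 s t →
                x ∈ (⁅ u ⁆ ∪ ⁅ v ⁆) ∩ minus2 s t ⊎
                ∃ λ y → y ∈ (⁅ u ⁆ ∪ ⁅ v ⁆) ∩ minus2 s t × A y x ≡ true
    dominated x x∈W with x ≟ u | x ≟ v
    ... | yes x≡u | _       = inj₁ (pair∋ (inj₁ x≡u) x∈W)
    ... | no _    | yes x≡v = inj₁ (pair∋ (inj₂ x≡v) x∈W)
    ... | no x≢u  | no x≢v with connex x≢u | connex x≢v
    ...   | inj₂ ux | _       = inj₂ (u , pair∋ (inj₁ refl) (beats⇒∈minus2 u≢s ux) , ux)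
    ...   | inj₁ _  | inj₂ vx = inj₂ (v , pair∋ (inj₂ refl) (beats⇒∈minus2 v≢s vx) , vx)
    ...   | inj₁ xu | inj₁ xv = ⊥-elim (proj₁ (∈-minus2⁻ x∈W) (only-s x xu xv))

  γ>2⇒commonIn≢1 : (γ> 2) A (minus2 s t) → (u v : Fin n) → commonIn A u v ≢ 1
  γ>2⇒commonIn≢1 γ>2 u v c≡1 with count≡1⇒∃-unique (λ w → A w u ∧ A w v) c≡1
  ... | w , wuv , only =
    <⇒≱ (γ>2 _ (pair-dominates u≢s v≢s only-s))
        (≤-trans (∣p∩q∣≤∣p∣ (⁅ u ⁆ ∪ ⁅ v ⁆) (minus2 s t)) (∣⁅x⁆∪⁅y⁆∣≤2 u v))
    where
    u≢s : u ≢ s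
    u≢s refl = nothing-beats-transmitter (∧-conicalˡ _ _ wuv)
    v≢s : v ≢ s
    v≢s refl = nothing-beats-transmitter (∧-conicalʳ _ _ wuv)
    only-s : ∀ x → A x u ≡ true → A x v ≡ true → x ≡ s
    only-s x xu xv =
      trans (only x (cong₂ _∧_ xu xv)) (sym (only s (cong₂ _∧_ (tr u u≢s) (tr v v≢s))))

  InQuadrangular⇔γ>2 : Nonempty (minus2 s t) → InQuadrangular A ⇔ (γ> 2) A (minus2 s t)
  InQuadrangular⇔γ>2 W-nonempty = mk⇔
    (λ inQuad _ S-dom → dominating⇒3≤∣S∣ inQuad S-dom W-nonempty)
    (λ γ>2 u v _ → γ>2⇒commonIn≢1 γ>2 u v)

theorem1 : (n : ℕ) → n ≥ 3 → (A : Digraph n) → IsTournament A →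
    (s t : Fin n) → Transmitter A s → Receiver A t →
    Quadrangular A ⇔ ((γ> 2) A (minus2 s t) × (γ> 2) (reverse A) (minus2 s t))
theorem1 n n≥3 A tour s t tr rc =
  (InQuadrangular⇔γ>2 tour tr rc (minus2-nonempty n≥3 s t) ×-⇔ reversed)
    ⇔-∘ Quadrangular⇔InQuadrangular×reverse A
  where
  reversed : InQuadrangular (reverse A) ⇔ (γ> 2) (reverse A) (minus2 s t)
  reversed = subst (λ W → InQuadrangular (reverse A) ⇔ (γ> 2) (reverse A) W) (minus2-comm t s)
    (InQuadrangular⇔γ>2 (reverse-isTournament tour) rc tr (minus2-nonempty n≥3 t s))
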